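{- Let $p$ be a prime, $\overline x=x_1,\dots,x_N$, and let $\mathcal F\subseteq\mathbb F_p[\overline x]$ be a finite set containing $x_i^2-x_i$ for all $i\le N$. Let $h\ge1$ and let $\mathcal E$ be a finite set of unstructured extension polynomials of accuracy $h$ such that $|\mathcal E|<e^{h/p}$. Assume that $\mathcal F\cup\mathcal E\cup\mathcal R(\mathcal E)$ has an NS-refutation. Then $\mathcal F$ is unsolvable, i.e. there is no $\overline a\in\mathbb F_p^N$ with $f(\overline a)=0$ for all $f\in\mathcal F$.
   Context: An unstructured extension polynomial of accuracy $h\ge1$ is a polynomial in $\mathbb F_p[\overline x,\overline r]$ of the form $(g_1-r_1)\cdots(g_h-r_h)$, where $\overline r$ are new (extension) variables and no $r_i$ occurs in any $g_j$ (the $r_i$ may occur in other unstructured extension polynomials of the set). $\mathcal R(\mathcal E)$ is the set of polynomials $r^p-r$ for all extension variables $r$ occurring in $\mathcal E$. An NS-refutation of a finite set $\mathcal G$ of polynomials over $\mathbb F_p$ is a tuple $(h_g)_{g\in\mathcal G}$ of polynomials with $\sum_{g\in\mathcal G}h_g g=1$ in the polynomial ring over $\mathbb F_p$ in all the variables involved. -}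

module Defs where

open import Data.Nat using (ℕ; zero; suc; _!)
import Data.Nat as ℕ
open import Data.Nat.Properties using (_!≢0)
open import Data.Integer as ℤ using (ℤ; +_)
open import Data.Rational.Unnormalised as Q using (ℚᵘ; 0ℚᵘ)
open import Data.Fin using (Fin)
open import Data.Sum using (_⊎_; inj₁; inj₂)
open import Data.Product using (Σ; _×_)
open import Data.List using (List; []; _∷_; map; _++_; concatMap; allFin; length; lookup; upTo)
import Data.List as L
open import Data.Unit using (⊤)
open import Relation.Binary.PropositionalEquality using (_≡_; _≢_)

-- Terms of the free commutative ring on V, with natural-number constants;
-- the relation  p ⊢ a ≈ b  is the congruence generated by the commutative
-- ring axioms, the equations  con (suc n) = 1 + con n  and  con p = 0.
-- Hence Term V / (p ⊢ _≈_) is exactly ℤ[V]/(p) = F_p[V].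

infixl 6 _⊕_ _⊖_
infixl 7 _⊗_
infix 8 ⊝_

data Term (V : Set) : Set where
  var : V → Term V
  con : ℕ → Term V
  _⊕_ : Term V → Term V → Term V
  _⊗_ : Term V → Term V → Term V
  ⊝_  : Term V → Term V

_⊖_ : ∀ {V} → Term V → Term V → Term V
a ⊖ b = a ⊕ (⊝ b)

_^T_ : ∀ {V} → Term V → ℕ → Term V
a ^T zero  = con 1
a ^T suc n = a ⊗ (a ^T n)

infix 4 _⊢_≈_

data _⊢_≈_ (p : ℕ) {V : Set} : Term V → Term V → Set where
  ≈refl  : ∀ {a} → p ⊢ a ≈ a
  ≈sym   : ∀ {a b} → p ⊢ a ≈ b → p ⊢ b ≈ a
  ≈trans : ∀ {a b c} → p ⊢ a ≈ b → p ⊢ b ≈ c → p ⊢ a ≈ c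
  ⊕-cong : ∀ {a b c d} → p ⊢ a ≈ b → p ⊢ c ≈ d → p ⊢ a ⊕ c ≈ b ⊕ d
  ⊗-cong : ∀ {a b c d} → p ⊢ a ≈ b → p ⊢ c ≈ d → p ⊢ a ⊗ c ≈ b ⊗ d
  ⊝-cong : ∀ {a b} → p ⊢ a ≈ b → p ⊢ ⊝ a ≈ ⊝ b
  ⊕-assoc : ∀ a b c → p ⊢ (a ⊕ b) ⊕ c ≈ a ⊕ (b ⊕ c)
  ⊕-comm  : ∀ a b → p ⊢ a ⊕ b ≈ b ⊕ a
  ⊕-idˡ   : ∀ a → p ⊢ con 0 ⊕ a ≈ a
  ⊝-invˡ  : ∀ a → p ⊢ (⊝ a) ⊕ a ≈ con 0
  ⊗-assoc : ∀ a b c → p ⊢ (a ⊗ b) ⊗ c ≈ a ⊗ (b ⊗ c)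
  ⊗-comm  : ∀ a b → p ⊢ a ⊗ b ≈ b ⊗ a
  ⊗-idˡ   : ∀ a → p ⊢ con 1 ⊗ a ≈ a
  distribˡ : ∀ a b c → p ⊢ a ⊗ (b ⊕ c) ≈ (a ⊗ b) ⊕ (a ⊗ c)
  con-suc  : ∀ n → p ⊢ con (suc n) ≈ con 1 ⊕ con n
  con-char : p ⊢ con p ≈ con 0

rename : ∀ {V W} → (V → W) → Term V → Term W
rename f (var v) = var (f v)
rename f (con n) = con n
rename f (a ⊕ b) = rename f a ⊕ rename f b
rename f (a ⊗ b) = rename f a ⊗ rename f b
rename f (⊝ a)   = ⊝ rename f a

NoOcc : ∀ {V} → V → Term V → Set
NoOcc v (var w) = w ≢ v
NoOcc v (con n) = ⊤
NoOcc v (a ⊕ b) = NoOcc v a × NoOcc v b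
NoOcc v (a ⊗ b) = NoOcc v a × NoOcc v b
NoOcc v (⊝ a)   = NoOcc v a

FreeOf : ∀ {V} → ℕ → V → Term V → Set
FreeOf p v g = Σ _ λ t → (p ⊢ t ≈ g) × NoOcc v t

sumFin : ∀ {V} n → (Fin n → Term V) → Term V
sumFin n f = L.foldr _⊕_ (con 0) (map f (allFin n))

prodFin : ∀ {V} n → (Fin n → Term V) → Term V
prodFin n f = L.foldr _⊗_ (con 1) (map f (allFin n))

-- Variables: x_1..x_N  (inj₁) and extension variables r ∈ Fin M (inj₂).

Var : ℕ → ℕ → Set
Var N M = Fin N ⊎ Fin M

xv : ∀ {N} → Fin N → Term (Fin N)
xv i = var i

record ExtPoly (p N M h : ℕ) : Set where
  field
    g     : Fin h → Term (Var N M)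
    r     : Fin h → Fin M
    r-inj : ∀ i j → r i ≡ r j → i ≡ j
    fresh : ∀ i j → FreeOf p (inj₂ (r i)) (g j)

  poly : Term (Var N M)
  poly = prodFin h (λ i → g i ⊖ var (inj₂ (r i)))

open ExtPoly public

Rset : ∀ {p N M h} → List (ExtPoly p N M h) → List (Term (Var N M))
Rset {p} {h = h} E =
  concatMap (λ e → map (λ i → (var (inj₂ (r e i)) ^T p) ⊖ var (inj₂ (r e i))) (allFin h)) E

NSRefutation : ∀ {V} → ℕ → List (Term V) → Set
NSRefutation {V} p G =
  Σ (Fin (length G) → Term V) λ hs →
    p ⊢ sumFin (length G) (λ i → hs i ⊗ lookup G i) ≈ con 1

-- Evaluation of f ∈ F_p[x] at a ∈ F_p^N (F_p = Fin p), as an integer;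
-- f(a) = 0 in F_p  iff  p divides this integer.
eval : ∀ {N p} → (Fin N → Fin p) → Term (Fin N) → ℤ
eval a (var i) = + Data.Fin.toℕ (a i)
eval a (con n) = + n
eval a (f ⊕ g) = eval a f ℤ.+ eval a g
eval a (f ⊗ g) = eval a f ℤ.* eval a g
eval a (⊝ f)   = ℤ.- eval a f

-- The real-number inequality  m < e^(h/p)  (p > 0), i.e.  m^p < e^h.
-- Since e^h = sup_n Σ_{k≤n} h^k/k! (increasing partial sums), m^p < e^h
-- iff some partial sum exceeds m^p.
expPartial : ℕ → ℕ → ℚᵘ
expPartial h n = L.foldr Q._+_ 0ℚᵘ
  (map (λ k → ((+ (h ℕ.^ k)) Q./ (k !)) {{k !≢0}}) (upTo (suc n)))

LtExp : (m h p : ℕ) → Set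
LtExp m h p = Σ ℕ λ n → (+ (m ℕ.^ p)) Q./ 1 Q.< expPartial h n

module Submission where

-- Fix a common zero a ∈ F_p^N of F and choose the extension variables r uniformly at
-- random in F_p^M. Every factor g_i - r_i of an extension polynomial e vanishes with
-- probability 1/p, independently of the others, because r_i occurs in no g_j; so e is
-- nonzero with probability at most (1 - 1/p)^h. Since 1 - 1/p ≤ e^(-1/p), the
-- hypothesis |E| < e^(h/p) makes the union bound |E| (1 - 1/p)^h less than 1, so some
-- choice of r makes every e vanish, while r^p - r vanishes by Fermat's little theorem.
-- At such a point, evaluated in ℤ and read modulo p, the refutation Σ h_g g = 1 gives
-- 0 ≡ 1. The exponential is handled through the series (1 - 1/p)^(-hp) =
-- Σ_k multichoose(hp, k) / p^k, whose terms dominate those of e^h = Σ_k h^k / k!.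

open import Defs
open import Data.Nat using (ℕ; _≤_)
open import Data.Nat.Primality using (Prime)
open import Data.Integer using (+_)
open import Data.Integer.Divisibility using (_∣_)
open import Data.Fin using (Fin)
open import Data.Sum using (inj₁)
open import Data.Product using (Σ)
open import Data.List using (List; map; _++_; length)
open import Data.List.Relation.Unary.Any using (Any)
open import Data.List.Relation.Unary.All using (All)
open import Data.List.Relation.Unary.AllPairs using (AllPairs)
open import Relation.Nullary using (¬_)

open import Data.Product using (_,_)
open import Function using (_∘_; id)
open import Relation.Binary.PropositionalEquality

module ExponentialBound where

  open import Data.Nat as ℕ using (zero; suc; _+_; _*_; _^_; _<_; _!; z≤n; NonZero)
  open import Data.Nat.Properties
  open import Data.Nat.Tactic.RingSolver using (solve-∀)
  import Data.Integer as ℤ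
  import Data.Integer.Properties as ℤ
  open import Data.Rational.Unnormalised as ℚ using (ℚᵘ; 0ℚᵘ; mkℚᵘ)
  import Data.Rational.Unnormalised.Properties as ℚ
  open import Data.List as List using ([]; _∷_; _∷ʳ_; upTo)
  import Data.List.Properties as List
  open import Relation.Nullary using (yes; no; contradiction)

  m^k<n^k⇒m<n : ∀ k {m n} → m ^ k < n ^ k → m < n
  m^k<n^k⇒m<n k {m} {n} mᵏ<nᵏ with m <? n
  ... | yes m<n = m<n
  ... | no  m≮n = contradiction (^-monoˡ-≤ k (≮⇒≥ m≮n)) (<⇒≱ mᵏ<nᵏ)

  [m*n]^k≡m^k*n^k : ∀ m n k → (m * n) ^ k ≡ m ^ k * n ^ k
  [m*n]^k≡m^k*n^k m n zero    = refl
  [m*n]^k≡m^k*n^k m n (suc k) = trans (cong (m * n *_) ([m*n]^k≡m^k*n^k m n k)) (interchange m n (m ^ k) (n ^ k))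
    where
    interchange : ∀ a b x y → a * b * (x * y) ≡ a * x * (b * y)
    interchange = solve-∀

  -- multichoose t k = C(t + k - 1, k), the number of k-element multisets of a t-element set.
  multichoose : ℕ → ℕ → ℕ
  multichoose zero    zero    = 1
  multichoose zero    (suc k) = 0
  multichoose (suc t) zero    = 1
  multichoose (suc t) (suc k) = multichoose (suc t) k + multichoose t (suc k)

  [1+t]^[1+k]≤[1+k]*[1+t]^k+t^[1+k] : ∀ t k → suc t ^ suc k ≤ suc k * suc t ^ k + t ^ suc k
  [1+t]^[1+k]≤[1+k]*[1+t]^k+t^[1+k] t zero    = ≤-refl
  [1+t]^[1+k]≤[1+k]*[1+t]^k+t^[1+k] t (suc k) = begin
    suc t * suc t ^ suc k
      ≤⟨ *-monoʳ-≤ (suc t) ([1+t]^[1+k]≤[1+k]*[1+t]^k+t^[1+k] t k) ⟩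
    suc t * (suc k * suc t ^ k + t ^ suc k)
      ≡⟨ expand t k (suc t ^ k) (t ^ suc k) ⟩
    suc k * suc t ^ suc k + t ^ suc k + t ^ suc (suc k)
      ≤⟨ +-monoˡ-≤ (t ^ suc (suc k)) (+-monoʳ-≤ (suc k * suc t ^ suc k) tᵏ⁺¹≤[1+t]ᵏ⁺¹) ⟩
    suc k * suc t ^ suc k + suc t ^ suc k + t ^ suc (suc k)
      ≡⟨ cong (_+ t ^ suc (suc k)) (+-comm _ (suc t ^ suc k)) ⟩
    suc (suc k) * suc t ^ suc k + t ^ suc (suc k) ∎
    where
    open ≤-Reasoning
    tᵏ⁺¹≤[1+t]ᵏ⁺¹ = ^-monoˡ-≤ (suc k) (n≤1+n t)
    expand : ∀ t k x y → suc t * (suc k * x + y) ≡ suc k * (suc t * x) + y + t * y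
    expand = solve-∀

  ^≤!*multichoose : ∀ t k → t ^ k ≤ k ! * multichoose t k
  ^≤!*multichoose zero    zero    = ≤-refl
  ^≤!*multichoose (suc t) zero    = ≤-refl
  ^≤!*multichoose zero    (suc k) = z≤n
  ^≤!*multichoose (suc t) (suc k) = begin
    suc t ^ suc k
      ≤⟨ [1+t]^[1+k]≤[1+k]*[1+t]^k+t^[1+k] t k ⟩
    suc k * suc t ^ k + t ^ suc k
      ≤⟨ +-mono-≤ (*-monoʳ-≤ (suc k) (^≤!*multichoose (suc t) k)) (^≤!*multichoose t (suc k)) ⟩
    suc k * (k ! * multichoose (suc t) k) + suc k ! * multichoose t (suc k)
      ≡⟨ collect (suc k) (k !) _ _ ⟩
    suc k ! * multichoose (suc t) (suc k) ∎
    where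
    open ≤-Reasoning
    collect : ∀ a b x y → a * (b * x) + (a * b) * y ≡ (a * b) * (x + y)
    collect = solve-∀

  x*e≤y*d⇒x/d≤y/e : ∀ x y d e .{{_ : NonZero d}} .{{_ : NonZero e}} →
                     x * e ≤ y * d → (+ x) ℚ./ d ℚ.≤ (+ y) ℚ./ e
  x*e≤y*d⇒x/d≤y/e x y (suc d) (suc e) le =
    ℚ.*≤* (subst₂ ℤ._≤_ (ℤ.pos-* x (suc e)) (ℤ.pos-* y (suc d)) (ℤ.+≤+ le))

  x/d<y/e⇒x*e<y*d : ∀ x y d e .{{_ : NonZero d}} .{{_ : NonZero e}} →
                     (+ x) ℚ./ d ℚ.< (+ y) ℚ./ e → x * e < y * d
  x/d<y/e⇒x*e<y*d x y (suc d) (suc e) (ℚ.*<* lt) =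
    ℤ.drop‿+<+ (subst₂ ℤ._<_ (sym (ℤ.pos-* x (suc e))) (sym (ℤ.pos-* y (suc d))) lt)

  x/d+y/e≡[x*e+y*d]/[d*e] : ∀ x y d e .{{_ : NonZero d}} .{{_ : NonZero e}} →
    (+ x) ℚ./ d ℚ.+ (+ y) ℚ./ e ≡ ((+ (x * e + y * d)) ℚ./ (d * e)) {{m*n≢0 d e}}
  x/d+y/e≡[x*e+y*d]/[d*e] x y (suc d) (suc e) = cong (λ n → mkℚᵘ n (e + d * suc e))
    (trans (cong₂ ℤ._+_ (sym (ℤ.pos-* x (suc e))) (sym (ℤ.pos-* y (suc d)))) (sym (ℤ.pos-+ (x * suc e) (y * suc d))))

  expPartial-suc : ∀ h n → expPartial h (suc n) ≡ expPartial h n ℚ.+ ((+ (h ^ suc n)) ℚ./ suc n !) {{suc n !≢0}}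
  expPartial-suc h n = begin
    sum (List.map term (upTo (suc (suc n))))
      ≡⟨ cong (sum ∘ List.map term) (List.applyUpTo-∷ʳ id (suc n)) ⟨
    sum (List.map term (upTo (suc n) ∷ʳ suc n))
      ≡⟨ cong sum (List.map-++ term (upTo (suc n)) (suc n ∷ [])) ⟩
    sum (List.map term (upTo (suc n)) ∷ʳ term (suc n))
      ≡⟨ sum-∷ʳ (List.map term (upTo (suc n))) (term (suc n)) ⟩
    sum (List.map term (upTo (suc n))) ℚ.+ term (suc n) ∎
    where
    open ≡-Reasoning
    sum = List.foldr ℚ._+_ 0ℚᵘ
    term : ℕ → ℚᵘ
    term k = ((+ (h ^ k)) ℚ./ k !) {{k !≢0}}
    sum-∷ʳ : ∀ xs x → sum (xs ∷ʳ x) ≡ sum xs ℚ.+ x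
    sum-∷ʳ []       x = trans (ℚ.+-identityʳ-≡ x) (sym (ℚ.+-identityˡ-≡ x))
    sum-∷ʳ (y ∷ xs) x = trans (cong (y ℚ.+_) (sum-∷ʳ xs x)) (sym (ℚ.+-assoc-≡ y _ x))

  -- p ^ n times the n-th partial sum of the negative binomial series
  -- (1 - 1/p) ^ (- t) = Σ multichoose t k / p ^ k, where p = 1 + q.
  module NegativeBinomial (q : ℕ) where

    negBinomialPartial : ℕ → ℕ → ℕ
    negBinomialPartial t zero    = 1
    negBinomialPartial t (suc n) = suc q * negBinomialPartial t n + multichoose t (suc n)

    negBinomialPartial-zero : ∀ n → negBinomialPartial 0 n ≡ suc q ^ n
    negBinomialPartial-zero zero    = refl
    negBinomialPartial-zero (suc n) = trans (+-identityʳ _) (cong (suc q *_) (negBinomialPartial-zero n))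

    negBinomialPartial-suc : ∀ t n →
      q * negBinomialPartial (suc t) n + multichoose (suc t) n ≡ suc q * negBinomialPartial t n
    negBinomialPartial-suc t zero    = +-comm (q * 1) 1
    negBinomialPartial-suc t (suc n) = begin
      q * (suc q * N′ + (A + a)) + (A + a) ≡⟨ regroup q N′ A a ⟩
      suc q * ((q * N′ + A) + a)           ≡⟨ cong (λ x → suc q * (x + a)) (negBinomialPartial-suc t n) ⟩
      suc q * (suc q * negBinomialPartial t n + a) ∎
      where
      open ≡-Reasoning
      N′ = negBinomialPartial (suc t) n
      A  = multichoose (suc t) n
      a  = multichoose t (suc n)
      regroup : ∀ q N′ A a → q * (suc q * N′ + (A + a)) + (A + a) ≡ suc q * ((q * N′ + A) + a)
      regroup = solve-∀

    negBinomialPartial*q^t≤[1+q]^[n+t] : ∀ t n → negBinomialPartial t n * q ^ t ≤ suc q ^ (n + t)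
    negBinomialPartial*q^t≤[1+q]^[n+t] zero n = begin
      negBinomialPartial 0 n * 1 ≡⟨ *-identityʳ _ ⟩
      negBinomialPartial 0 n     ≡⟨ negBinomialPartial-zero n ⟩
      suc q ^ n                  ≡⟨ cong (suc q ^_) (+-identityʳ n) ⟨
      suc q ^ (n + 0)            ∎
      where open ≤-Reasoning
    negBinomialPartial*q^t≤[1+q]^[n+t] (suc t) n = begin
      N′ * (q * q ^ t)           ≡⟨ *-assoc N′ q (q ^ t) ⟨
      N′ * q * q ^ t             ≤⟨ *-monoˡ-≤ (q ^ t) qN′≤[1+q]N ⟩
      suc q * N * q ^ t          ≡⟨ *-assoc (suc q) N (q ^ t) ⟩
      suc q * (N * q ^ t)        ≤⟨ *-monoʳ-≤ (suc q) (negBinomialPartial*q^t≤[1+q]^[n+t] t n) ⟩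
      suc q * suc q ^ (n + t)    ≡⟨ cong (suc q ^_) (+-suc n t) ⟨
      suc q ^ (n + suc t)        ∎
      where
      open ≤-Reasoning
      N′ = negBinomialPartial (suc t) n
      N  = negBinomialPartial t n
      qN′≤[1+q]N : N′ * q ≤ suc q * N
      qN′≤[1+q]N = begin
        N′ * q                            ≡⟨ *-comm N′ q ⟩
        q * N′                            ≤⟨ m≤m+n (q * N′) (multichoose (suc t) n) ⟩
        q * N′ + multichoose (suc t) n    ≡⟨ negBinomialPartial-suc t n ⟩
        suc q * N                         ∎

  module _ (q h : ℕ) where
    open NegativeBinomial q

    private
      p = suc q

      _/p^_ : ℕ → ℕ → ℚᵘ
      x /p^ n = ((+ x) ℚ./ (p ^ n)) {{m^n≢0 p n}}

    h^k/k!≤multichoose/p^k : ∀ k → ((+ (h ^ k)) ℚ./ k !) {{k !≢0}} ℚ.≤ multichoose (h * p) k /p^ k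
    h^k/k!≤multichoose/p^k k = x*e≤y*d⇒x/d≤y/e _ _ (k !) (p ^ k) {{k !≢0}} {{m^n≢0 p k}} (begin
      h ^ k * p ^ k               ≡⟨ [m*n]^k≡m^k*n^k h p k ⟨
      (h * p) ^ k                 ≤⟨ ^≤!*multichoose (h * p) k ⟩
      k ! * multichoose (h * p) k ≡⟨ *-comm (k !) _ ⟩
      multichoose (h * p) k * k ! ∎)
      where open ≤-Reasoning

    expPartial≤negBinomialPartial/p^n : ∀ n → expPartial h n ℚ.≤ negBinomialPartial (h * p) n /p^ n
    expPartial≤negBinomialPartial/p^n zero    =
      ℚ.≤-trans (ℚ.≤-reflexive-≡ (ℚ.+-identityʳ-≡ _)) (x*e≤y*d⇒x/d≤y/e 1 1 1 1 ≤-refl)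
    expPartial≤negBinomialPartial/p^n (suc n) = begin
      expPartial h (suc n)                                    ≡⟨ expPartial-suc h n ⟩
      expPartial h n ℚ.+ ((+ (h ^ suc n)) ℚ./ suc n !) {{suc n !≢0}}
        ≤⟨ ℚ.+-mono-≤ (expPartial≤negBinomialPartial/p^n n) (h^k/k!≤multichoose/p^k (suc n)) ⟩
      N /p^ n ℚ.+ a /p^ suc n
        ≡⟨ x/d+y/e≡[x*e+y*d]/[d*e] N a (p ^ n) (p ^ suc n) {{m^n≢0 p n}} {{m^n≢0 p (suc n)}} ⟩
      ((+ (N * p ^ suc n + a * p ^ n)) ℚ./ (p ^ n * p ^ suc n)) {{pⁿpⁿ⁺¹≢0}}
        ≤⟨ x*e≤y*d⇒x/d≤y/e _ _ (p ^ n * p ^ suc n) (p ^ suc n) {{pⁿpⁿ⁺¹≢0}} {{m^n≢0 p (suc n)}}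
             (≤-reflexive (factor N a p (p ^ n))) ⟩
      (p * N + a) /p^ suc n                                   ∎
      where
      open ℚ.≤-Reasoning
      N = negBinomialPartial (h * p) n
      a = multichoose (h * p) (suc n)
      pⁿpⁿ⁺¹≢0 : NonZero (p ^ n * p ^ suc n)
      pⁿpⁿ⁺¹≢0 = m*n≢0 (p ^ n) (p ^ suc n) {{m^n≢0 p n}} {{m^n≢0 p (suc n)}}
      factor : ∀ N a p x → (N * (p * x) + a * x) * (p * x) ≡ (p * N + a) * (x * (p * x))
      factor = solve-∀

    LtExp⇒m*q^h<[1+q]^h : ∀ m → 1 ≤ q → LtExp m h p → m * q ^ h < p ^ h
    LtExp⇒m*q^h<[1+q]^h m 1≤q (n , m^p<expPartial) = m^k<n^k⇒m<n p (begin-strict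
      (m * q ^ h) ^ p       ≡⟨ [m*n]^k≡m^k*n^k m (q ^ h) p ⟩
      m ^ p * (q ^ h) ^ p   ≡⟨ cong (m ^ p *_) (^-*-assoc q h p) ⟩
      m ^ p * q ^ (h * p)   <⟨ *-cancelʳ-< (p ^ n) _ _ m^p*q^[hp]*p^n<p^[hp]*p^n ⟩
      p ^ (h * p)           ≡⟨ ^-*-assoc p h p ⟨
      (p ^ h) ^ p           ∎)
      where
      open ≤-Reasoning
      N = negBinomialPartial (h * p) n
      swap : ∀ x y z → x * y * z ≡ x * z * y
      swap = solve-∀
      m^p*p^n<N : m ^ p * p ^ n < N
      m^p*p^n<N = subst (m ^ p * p ^ n <_) (*-identityʳ N)
        (x/d<y/e⇒x*e<y*d (m ^ p) N 1 (p ^ n) {{_}} {{m^n≢0 p n}}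
          (ℚ.<-≤-trans m^p<expPartial (expPartial≤negBinomialPartial/p^n n)))
      m^p*q^[hp]*p^n<p^[hp]*p^n : m ^ p * q ^ (h * p) * p ^ n < p ^ (h * p) * p ^ n
      m^p*q^[hp]*p^n<p^[hp]*p^n = begin-strict
        m ^ p * q ^ (h * p) * p ^ n ≡⟨ swap (m ^ p) _ _ ⟩
        m ^ p * p ^ n * q ^ (h * p) <⟨ *-monoˡ-< (q ^ (h * p)) {{m^n≢0 q (h * p) {{ℕ.>-nonZero 1≤q}}}} m^p*p^n<N ⟩
        N * q ^ (h * p)             ≤⟨ negBinomialPartial*q^t≤[1+q]^[n+t] (h * p) n ⟩
        p ^ (n + h * p)             ≡⟨ ^-distribˡ-+-* p n (h * p) ⟩
        p ^ n * p ^ (h * p)         ≡⟨ *-comm (p ^ n) _ ⟩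
        p ^ (h * p) * p ^ n         ∎

module Congruence (p : ℕ) where

  open import Data.Integer as ℤ using (ℤ; 0ℤ; 1ℤ; _+_; _-_; _*_; -_)
  import Data.Integer.Properties as ℤ
  import Data.Integer.Divisibility.Signed as ℤ
  open import Data.Integer.Tactic.RingSolver using (solve-∀)
  open import Relation.Nullary using (Dec)
  open import Relation.Nullary.Decidable using (map′)

  infix 4 _≡ₚ_
  -- A record rather than an abbreviation of + p ∣ x - y, so that x and y stay inferable.
  record _≡ₚ_ (x y : ℤ) : Set where
    constructor mod-p
    field p∣x-y : + p ℤ.∣ x - y

  ≡⇒≡ₚ : ∀ {x y} → x ≡ y → x ≡ₚ y
  ≡⇒≡ₚ {x} refl = mod-p (ℤ.divides 0ℤ (ℤ.+-inverseʳ x))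

  ≡ₚ-refl : ∀ {x} → x ≡ₚ x
  ≡ₚ-refl = ≡⇒≡ₚ refl

  ≡ₚ-sym : ∀ {x y} → x ≡ₚ y → y ≡ₚ x
  ≡ₚ-sym {x} {y} (mod-p p∣x-y) = mod-p (subst (+ p ℤ.∣_) (regroup x y) (ℤ.∣m⇒∣-m p∣x-y))
    where regroup : ∀ x y → - (x - y) ≡ y - x
          regroup = solve-∀

  ≡ₚ-trans : ∀ {x y z} → x ≡ₚ y → y ≡ₚ z → x ≡ₚ z
  ≡ₚ-trans {x} {y} {z} (mod-p p∣x-y) (mod-p p∣y-z) =
    mod-p (subst (+ p ℤ.∣_) (regroup x y z) (ℤ.∣m∣n⇒∣m+n p∣x-y p∣y-z))
    where regroup : ∀ x y z → (x - y) + (y - z) ≡ x - z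
          regroup = solve-∀

  +-congₚ : ∀ {x y u v} → x ≡ₚ y → u ≡ₚ v → x + u ≡ₚ y + v
  +-congₚ {x} {y} {u} {v} (mod-p p∣x-y) (mod-p p∣u-v) =
    mod-p (subst (+ p ℤ.∣_) (regroup x y u v) (ℤ.∣m∣n⇒∣m+n p∣x-y p∣u-v))
    where regroup : ∀ x y u v → (x - y) + (u - v) ≡ (x + u) - (y + v)
          regroup = solve-∀

  *-congₚ : ∀ {x y u v} → x ≡ₚ y → u ≡ₚ v → x * u ≡ₚ y * v
  *-congₚ {x} {y} {u} {v} (mod-p p∣x-y) (mod-p p∣u-v) =
    mod-p (subst (+ p ℤ.∣_) (regroup x y u v) (ℤ.∣m∣n⇒∣m+n (ℤ.∣m⇒∣m*n u p∣x-y) (ℤ.∣n⇒∣m*n y p∣u-v)))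
    where regroup : ∀ x y u v → (x - y) * u + y * (u - v) ≡ x * u - y * v
          regroup = solve-∀

  -‿congₚ : ∀ {x y} → x ≡ₚ y → - x ≡ₚ - y
  -‿congₚ {x} {y} (mod-p p∣x-y) = mod-p (subst (+ p ℤ.∣_) (regroup x y) (ℤ.∣m⇒∣-m p∣x-y))
    where regroup : ∀ x y → - (x - y) ≡ - x - - y
          regroup = solve-∀

  ∣⇒≡ₚ0 : ∀ {x} → + p ℤ.∣ x → x ≡ₚ 0ℤ
  ∣⇒≡ₚ0 {x} = mod-p ∘ subst (+ p ℤ.∣_) (sym (ℤ.+-identityʳ x))

  ≡ₚ0⇒∣ : ∀ {x} → x ≡ₚ 0ℤ → + p ℤ.∣ x
  ≡ₚ0⇒∣ {x} (mod-p p∣x-0) = subst (+ p ℤ.∣_) (ℤ.+-identityʳ x) p∣x-0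

  ≡ₚ⇒-≡ₚ0 : ∀ {x y} → x ≡ₚ y → x - y ≡ₚ 0ℤ
  ≡ₚ⇒-≡ₚ0 (mod-p p∣x-y) = ∣⇒≡ₚ0 p∣x-y

  x≡ₚ0⇒x*y≡ₚ0 : ∀ {x} y → x ≡ₚ 0ℤ → x * y ≡ₚ 0ℤ
  x≡ₚ0⇒x*y≡ₚ0 y x≡0 = ≡ₚ-trans (*-congₚ x≡0 (≡ₚ-refl {y})) (≡⇒≡ₚ (ℤ.*-zeroˡ y))

  y≡ₚ0⇒x*y≡ₚ0 : ∀ x {y} → y ≡ₚ 0ℤ → x * y ≡ₚ 0ℤ
  y≡ₚ0⇒x*y≡ₚ0 x y≡0 = ≡ₚ-trans (*-congₚ (≡ₚ-refl {x}) y≡0) (≡⇒≡ₚ (ℤ.*-zeroʳ x))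

  p≡ₚ0 : + p ≡ₚ 0ℤ
  p≡ₚ0 = ∣⇒≡ₚ0 (ℤ.divides 1ℤ (sym (ℤ.*-identityˡ (+ p))))

  _≟ₚ0 : ∀ x → Dec (x ≡ₚ 0ℤ)
  x ≟ₚ0 = map′ ∣⇒≡ₚ0 ≡ₚ0⇒∣ (+ p ℤ.∣? x)

module FermatsLittleTheorem where

  open import Data.Nat as ℕ using (zero; suc; _<_; _∸_; _!)
  import Data.Nat.Properties as ℕ
  import Data.Nat.Divisibility as ℕ
  open import Data.Nat.Combinatorics using (_C_; nCn≡1; nCk≡n!/k![n-k]!; k![n∸k]!∣n!)
  open import Data.Nat.DivMod using (m/n*n≡m)
  open import Data.Nat.Primality using (euclidsLemma; prime⇒nonTrivial)
  open import Data.Integer as ℤ using (ℤ; 0ℤ; 1ℤ; _+_; _*_; _^_)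
  import Data.Integer.Properties as ℤ
  import Data.Integer.Divisibility.Signed as ℤ
  open import Data.Fin using (zero; suc; toℕ; inject₁; fromℕ)
  import Data.Fin.Properties as Fin
  open import Data.Vec.Functional using (tail; init)
  open import Data.Sum using (inj₂)
  open import Relation.Nullary using (contradiction)
  open import Algebra.Properties.CommutativeSemiring.Binomial ℤ.+-*-commutativeSemiring using (theorem; binomialTerm)
  open import Algebra.Properties.Semiring.Sum ℤ.+-*-semiring using (sum; sum-init-last)
  open import Algebra.Properties.Semiring.Mult ℤ.+-*-semiring using (_×_)
  open import Algebra.Properties.Semiring.Exp ℤ.+-*-semiring renaming (_^_ to _^ᴿ_)

  n!≡nCk*[k!*[n∸k]!] : ∀ {n k} → k ℕ.≤ n → n ! ≡ (n C k) ℕ.* (k ! ℕ.* (n ∸ k) !)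
  n!≡nCk*[k!*[n∸k]!] {n} {k} k≤n = sym (begin
    (n C k) ℕ.* D          ≡⟨ cong (ℕ._* D) (nCk≡n!/k![n-k]! {n} {k} k≤n) ⟩
    n ! ℕ./ D ℕ.* D        ≡⟨ m/n*n≡m (k![n∸k]!∣n! k≤n) ⟩
    n !                    ∎)
    where
    open ≡-Reasoning
    D = k ! ℕ.* (n ∸ k) !
    instance _ = ℕ._!*_!≢0 k (n ∸ k)

  -- The library's binomial theorem is stated with the generic semiring power and ℕ-multiple.
  ^ᴿ≡^ : ∀ x n → x ^ᴿ n ≡ x ^ n
  ^ᴿ≡^ x zero    = refl
  ^ᴿ≡^ x (suc n) = cong (x *_) (^ᴿ≡^ x n)

  ×≡* : ∀ n x → n × x ≡ + n * x
  ×≡* zero    x = refl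
  ×≡* (suc n) x = trans (cong (λ z → x + z) (×≡* n x)) (sym (ℤ.suc-* (+ n) x))

  -- The middle sum collects the binomial terms of index k = 1 + i, for i < m.
  [1+y]^[1+m]≡y^[1+m]+middle+1 : ∀ m y →
    (1ℤ + y) ^ suc m ≡ y ^ suc m + (sum (λ i → binomialTerm 1ℤ y (suc m) (suc (inject₁ i))) + 1ℤ)
  [1+y]^[1+m]≡y^[1+m]+middle+1 m y = begin
    (1ℤ + y) ^ suc m       ≡⟨ ^ᴿ≡^ (1ℤ + y) (suc m) ⟨
    (1ℤ + y) ^ᴿ suc m      ≡⟨ theorem (suc m) 1ℤ y ⟩
    T zero + sum (tail T)  ≡⟨ cong₂ _+_ first (trans (sum-init-last (tail T)) (cong (λ z → sum (init (tail T)) + z) last)) ⟩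
    y ^ suc m + (sum (λ i → T (suc (inject₁ i))) + 1ℤ) ∎
    where
    open ≡-Reasoning
    T = binomialTerm 1ℤ y (suc m)
    first : T zero ≡ y ^ suc m
    first = trans (ℤ.+-identityʳ _) (trans (ℤ.*-identityˡ _) (^ᴿ≡^ y (suc m)))
    term : ℕ → ℤ
    term k = (suc m C suc k) × (1ℤ ^ᴿ suc k * y ^ᴿ (m ∸ k))
    last : T (suc (fromℕ m)) ≡ 1ℤ
    last = begin
      term (toℕ (fromℕ m))                                ≡⟨ cong term (Fin.toℕ-fromℕ m) ⟩
      (suc m C suc m) × (1ℤ ^ᴿ suc m * y ^ᴿ (m ∸ m))
        ≡⟨ cong₂ (λ c k → c × (1ℤ ^ᴿ suc m * y ^ᴿ k)) (nCn≡1 (suc m)) (ℕ.n∸n≡0 m) ⟩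
      1ℤ ^ᴿ suc m * 1ℤ + 0ℤ                               ≡⟨ trans (ℤ.+-identityʳ _) (ℤ.*-identityʳ _) ⟩
      1ℤ ^ᴿ suc m                                         ≡⟨ trans (^ᴿ≡^ 1ℤ (suc m)) (ℤ.^-zeroˡ (suc m)) ⟩
      1ℤ                                                  ∎

  ∣-sum : ∀ {d n} (f : Fin n → ℤ) → (∀ i → d ℤ.∣ f i) → d ℤ.∣ sum f
  ∣-sum {n = zero}  f d∣f = ℤ.divides 0ℤ refl
  ∣-sum {n = suc n} f d∣f = ℤ.∣m∣n⇒∣m+n (d∣f zero) (∣-sum (f ∘ suc) (d∣f ∘ suc))

  module _ {m : ℕ} (p-prime : Prime (suc m)) where

    open Congruence (suc m)

    private
      p = suc m

    p∤j! : ∀ j → j < p → ¬ p ℕ.∣ j !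
    p∤j! zero    _   p∣1 = contradiction (ℕ.∣1⇒≡1 p∣1) (ℕ.>⇒≢ (ℕ.nonTrivial⇒n>1 p {{prime⇒nonTrivial p-prime}}))
    p∤j! (suc j) j<p p∣j! with euclidsLemma (suc j) (j !) p-prime p∣j!
    ... | inj₁ p∣1+j = ℕ.<⇒≱ j<p (ℕ.∣⇒≤ p∣1+j)
    ... | inj₂ p∣j!  = p∤j! j (ℕ.<-trans (ℕ.n<1+n j) j<p) p∣j!

    p∣pCk : ∀ k → 0 < k → k < p → p ℕ.∣ p C k
    p∣pCk k 0<k k<p
      with euclidsLemma (p C k) _ p-prime (subst (p ℕ.∣_) (n!≡nCk*[k!*[n∸k]!] (ℕ.<⇒≤ k<p)) (ℕ.m∣m*n (m !)))
    ... | inj₁ p∣pCk = p∣pCk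
    ... | inj₂ p∣k![p∸k]! with euclidsLemma (k !) ((p ∸ k) !) p-prime p∣k![p∸k]!
    ...   | inj₁ p∣k!     = contradiction p∣k! (p∤j! k k<p)
    ...   | inj₂ p∣[p∸k]! = contradiction p∣[p∸k]! (p∤j! (p ∸ k) (ℕ.∸-monoʳ-< 0<k (ℕ.<⇒≤ k<p)))

    [1+y]^p≡ₚy^p+1 : ∀ y → (1ℤ + y) ^ p ≡ₚ y ^ p + 1ℤ
    [1+y]^p≡ₚy^p+1 y = subst (_≡ₚ y ^ p + 1ℤ) (sym ([1+y]^[1+m]≡y^[1+m]+middle+1 m y))
      (+-congₚ (≡ₚ-refl {y ^ p}) (+-congₚ (∣⇒≡ₚ0 {sum T} (∣-sum T p∣T)) (≡ₚ-refl {1ℤ})))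
      where
      T : Fin m → ℤ
      T i = binomialTerm 1ℤ y p (suc (inject₁ i))
      p∣T : ∀ i → + p ℤ.∣ T i
      p∣T i = subst (+ p ℤ.∣_) (sym (×≡* (p C k) _))
        (ℤ.∣m⇒∣m*n {m = + (p C k)} _ (ℤ.∣ᵤ⇒∣ (p∣pCk k ℕ.z<s (ℕ.s<s (Fin.inject₁ℕ< i)))))
        where k = suc (toℕ (inject₁ i))

    fermat : ∀ x → (+ x) ^ p ≡ₚ + x
    fermat zero    = ≡ₚ-refl
    fermat (suc x) = ≡ₚ-trans ([1+y]^p≡ₚy^p+1 (+ x))
      (≡ₚ-trans (+-congₚ (fermat x) ≡ₚ-refl) (≡⇒≡ₚ (ℤ.+-comm (+ x) 1ℤ)))

module Evaluation where

  open import Data.Nat as ℕ using (zero; suc; _<_)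
  import Data.Nat.Properties as ℕ
  import Data.Nat.Divisibility as ℕ
  open import Data.Integer as ℤ using (ℤ; 0ℤ; 1ℤ; _+_; _*_; -_; _^_)
  import Data.Integer.Properties as ℤ
  import Data.Integer.Divisibility.Signed as ℤ
  open import Data.Fin using (toℕ)
  open import Data.List as List using ([]; _∷_; allFin)
  import Data.List.Relation.Unary.All as All
  open import Data.List.Membership.Propositional.Properties using (∈-lookup)
  open import Relation.Nullary using (contradiction)

  ⟦_⟧ : ∀ {V} → Term V → (V → ℤ) → ℤ
  ⟦ var v ⟧ σ = σ v
  ⟦ con n ⟧ σ = + n
  ⟦ s ⊕ t ⟧ σ = ⟦ s ⟧ σ + ⟦ t ⟧ σ
  ⟦ s ⊗ t ⟧ σ = ⟦ s ⟧ σ * ⟦ t ⟧ σ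
  ⟦ ⊝ s ⟧ σ   = - ⟦ s ⟧ σ

  eval≡⟦⟧ : ∀ {N p} (a : Fin N → Fin p) f → eval a f ≡ ⟦ f ⟧ (λ i → + toℕ (a i))
  eval≡⟦⟧ a (var i) = refl
  eval≡⟦⟧ a (con n) = refl
  eval≡⟦⟧ a (s ⊕ t) = cong₂ _+_ (eval≡⟦⟧ a s) (eval≡⟦⟧ a t)
  eval≡⟦⟧ a (s ⊗ t) = cong₂ _*_ (eval≡⟦⟧ a s) (eval≡⟦⟧ a t)
  eval≡⟦⟧ a (⊝ s)   = cong -_ (eval≡⟦⟧ a s)

  ⟦rename⟧ : ∀ {V W} (f : V → W) t (σ : W → ℤ) → ⟦ rename f t ⟧ σ ≡ ⟦ t ⟧ (σ ∘ f)
  ⟦rename⟧ f (var v) σ = refl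
  ⟦rename⟧ f (con n) σ = refl
  ⟦rename⟧ f (s ⊕ t) σ = cong₂ _+_ (⟦rename⟧ f s σ) (⟦rename⟧ f t σ)
  ⟦rename⟧ f (s ⊗ t) σ = cong₂ _*_ (⟦rename⟧ f s σ) (⟦rename⟧ f t σ)
  ⟦rename⟧ f (⊝ s)   σ = cong -_ (⟦rename⟧ f s σ)

  ⟦^T⟧ : ∀ {V} (t : Term V) n σ → ⟦ t ^T n ⟧ σ ≡ ⟦ t ⟧ σ ^ n
  ⟦^T⟧ t zero    σ = refl
  ⟦^T⟧ t (suc n) σ = cong (⟦ t ⟧ σ *_) (⟦^T⟧ t n σ)

  ⟦⟧-noOcc : ∀ {V} {v : V} {σ τ : V → ℤ} t → NoOcc v t → (∀ w → w ≢ v → σ w ≡ τ w) → ⟦ t ⟧ σ ≡ ⟦ t ⟧ τ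
  ⟦⟧-noOcc (var w) w≢v σ≗τ = σ≗τ w w≢v
  ⟦⟧-noOcc (con n) _   σ≗τ = refl
  ⟦⟧-noOcc (s ⊕ t) (s∌v , t∌v) σ≗τ = cong₂ _+_ (⟦⟧-noOcc s s∌v σ≗τ) (⟦⟧-noOcc t t∌v σ≗τ)
  ⟦⟧-noOcc (s ⊗ t) (s∌v , t∌v) σ≗τ = cong₂ _*_ (⟦⟧-noOcc s s∌v σ≗τ) (⟦⟧-noOcc t t∌v σ≗τ)
  ⟦⟧-noOcc (⊝ s)   s∌v σ≗τ = cong -_ (⟦⟧-noOcc s s∌v σ≗τ)

  module _ {p : ℕ} {V : Set} where
    open Congruence p

    ⟦⟧-sound : ∀ {s t : Term V} σ → p ⊢ s ≈ t → ⟦ s ⟧ σ ≡ₚ ⟦ t ⟧ σ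
    ⟦⟧-sound σ ≈refl                = ≡ₚ-refl
    ⟦⟧-sound σ (≈sym s≈t)           = ≡ₚ-sym (⟦⟧-sound σ s≈t)
    ⟦⟧-sound σ (≈trans s≈t t≈u)     = ≡ₚ-trans (⟦⟧-sound σ s≈t) (⟦⟧-sound σ t≈u)
    ⟦⟧-sound σ (⊕-cong s≈t u≈v)     = +-congₚ (⟦⟧-sound σ s≈t) (⟦⟧-sound σ u≈v)
    ⟦⟧-sound σ (⊗-cong s≈t u≈v)     = *-congₚ (⟦⟧-sound σ s≈t) (⟦⟧-sound σ u≈v)
    ⟦⟧-sound σ (⊝-cong s≈t)         = -‿congₚ (⟦⟧-sound σ s≈t)
    ⟦⟧-sound σ (⊕-assoc a b c)      = ≡⇒≡ₚ (ℤ.+-assoc (⟦ a ⟧ σ) (⟦ b ⟧ σ) (⟦ c ⟧ σ))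
    ⟦⟧-sound σ (⊕-comm a b)         = ≡⇒≡ₚ (ℤ.+-comm (⟦ a ⟧ σ) (⟦ b ⟧ σ))
    ⟦⟧-sound σ (⊕-idˡ a)            = ≡⇒≡ₚ (ℤ.+-identityˡ (⟦ a ⟧ σ))
    ⟦⟧-sound σ (⊝-invˡ a)           = ≡⇒≡ₚ (ℤ.+-inverseˡ (⟦ a ⟧ σ))
    ⟦⟧-sound σ (⊗-assoc a b c)      = ≡⇒≡ₚ (ℤ.*-assoc (⟦ a ⟧ σ) (⟦ b ⟧ σ) (⟦ c ⟧ σ))
    ⟦⟧-sound σ (⊗-comm a b)         = ≡⇒≡ₚ (ℤ.*-comm (⟦ a ⟧ σ) (⟦ b ⟧ σ))
    ⟦⟧-sound σ (⊗-idˡ a)            = ≡⇒≡ₚ (ℤ.*-identityˡ (⟦ a ⟧ σ))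
    ⟦⟧-sound σ (distribˡ a b c)     = ≡⇒≡ₚ (ℤ.*-distribˡ-+ (⟦ a ⟧ σ) (⟦ b ⟧ σ) (⟦ c ⟧ σ))
    ⟦⟧-sound σ (con-suc n)          = ≡⇒≡ₚ (ℤ.pos-+ 1 n)
    ⟦⟧-sound σ con-char             = p≡ₚ0

    ⟦⟧-freeOf : ∀ {v : V} {σ τ : V → ℤ} g → FreeOf p v g →
                (∀ w → w ≢ v → σ w ≡ τ w) → ⟦ g ⟧ σ ≡ₚ ⟦ g ⟧ τ
    ⟦⟧-freeOf {σ = σ} {τ} g (t , t≈g , t∌v) σ≗τ =
      ≡ₚ-trans (⟦⟧-sound σ (≈sym t≈g)) (≡ₚ-trans (≡⇒≡ₚ (⟦⟧-noOcc t t∌v σ≗τ)) (⟦⟧-sound τ t≈g))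

    ⟦sum⟧≡ₚ0 : ∀ {A : Set} (f : A → Term V) xs σ → (∀ x → ⟦ f x ⟧ σ ≡ₚ 0ℤ) →
               ⟦ List.foldr _⊕_ (con 0) (List.map f xs) ⟧ σ ≡ₚ 0ℤ
    ⟦sum⟧≡ₚ0 f []       σ f≡0 = ≡ₚ-refl
    ⟦sum⟧≡ₚ0 f (x ∷ xs) σ f≡0 = +-congₚ (f≡0 x) (⟦sum⟧≡ₚ0 f xs σ f≡0)

    NSRefutation⇒¬commonZero : 1 < p → ∀ {G} → NSRefutation p G → ∀ σ → ¬ All (λ g → ⟦ g ⟧ σ ≡ₚ 0ℤ) G
    NSRefutation⇒¬commonZero 1<p {G} (hs , Σhg≈1) σ G≡0 =
      contradiction (ℕ.∣1⇒≡1 (ℤ.∣⇒∣ᵤ (≡ₚ0⇒∣ 1≡ₚ0))) (ℕ.>⇒≢ 1<p)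
      where
      Σhg≡ₚ0 : ⟦ sumFin (length G) (λ i → hs i ⊗ List.lookup G i) ⟧ σ ≡ₚ 0ℤ
      Σhg≡ₚ0 = ⟦sum⟧≡ₚ0 (λ i → hs i ⊗ List.lookup G i) (allFin (length G)) σ
                 (λ i → y≡ₚ0⇒x*y≡ₚ0 (⟦ hs i ⟧ σ) (All.lookup G≡0 (∈-lookup i)))
      1≡ₚ0 : 1ℤ ≡ₚ 0ℤ
      1≡ₚ0 = ≡ₚ-trans (≡ₚ-sym (⟦⟧-sound σ Σhg≈1)) Σhg≡ₚ0

module Counting where

  open import Data.Nat as ℕ using (zero; suc; _+_; _*_; _^_; z≤n; s≤s)
  import Data.Nat.Properties as ℕ
  open import Data.Nat.Tactic.RingSolver using (solve-∀)
  open import Data.Integer as ℤ using (ℤ; 0ℤ; _-_)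
  import Data.Integer.DivMod as ℤ
  import Data.Integer.Divisibility.Signed as ℤ
  open import Data.Integer.Tactic.RingSolver renaming (solve-∀ to ℤ-solve)
  open import Data.Fin using (zero; suc; toℕ; fromℕ<; punchIn)
  import Data.Fin.Properties as Fin
  open import Data.Vec using (Vec; []; _∷_; lookup; _[_]≔_)
  import Data.Vec.Properties as Vec
  open import Data.List as List using ([]; _∷_; allFin)
  import Data.List.Properties as List
  open import Data.List.Relation.Unary.All as All using ([]; _∷_)
  open import Data.List.Relation.Unary.All.Properties using (map⁺; ++⁺)
  open import Data.List.Relation.Unary.AllPairs using ([]; _∷_)
  open import Data.List.Relation.Unary.Unique.Propositional.Properties using (allFin⁺)
  open import Data.Sum using (inj₂)
  open import Data.Sum.Properties using (inj₂-injective)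
  open import Relation.Nullary using (yes; no; contradiction)
  open import Algebra.Properties.Semiring.Sum ℕ.+-*-semiring
    using (sum; sum-cong-≗; ∑-distrib-+; *-distribˡ-sum; *-distribʳ-sum; sum-remove)
  open Evaluation
  open FermatsLittleTheorem using (fermat)

  sum-mono : ∀ {n} {f g : Fin n → ℕ} → (∀ i → f i ≤ g i) → sum f ≤ sum g
  sum-mono {zero}  f≤g = z≤n
  sum-mono {suc n} f≤g = ℕ.+-mono-≤ (f≤g zero) (sum-mono (f≤g ∘ suc))

  sum-const : ∀ n c → sum {n} (λ _ → c) ≡ n * c
  sum-const zero    c = refl
  sum-const (suc n) c = cong (λ s → c + s) (sum-const n c)

  sum-≤1-with-zero : ∀ {q} {f : Fin (suc q) → ℕ} i → f i ≡ 0 → (∀ j → f j ≤ 1) → sum f ≤ q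
  sum-≤1-with-zero {q} {f} i fi≡0 f≤1 = begin
    sum f                       ≡⟨ sum-remove {i = i} f ⟩
    f i + sum (f ∘ punchIn i)   ≡⟨ cong (_+ sum (f ∘ punchIn i)) fi≡0 ⟩
    sum (f ∘ punchIn i)         ≤⟨ sum-mono (f≤1 ∘ punchIn i) ⟩
    sum {q} (λ _ → 1)           ≡⟨ trans (sum-const q 1) (ℕ.*-identityʳ q) ⟩
    q                           ∎
    where open ℕ.≤-Reasoning
  
  module SumOverVectors (n : ℕ) where

    ∑ᵥ : ∀ M → (Vec (Fin n) M → ℕ) → ℕ
    ∑ᵥ zero    f = f []
    ∑ᵥ (suc M) f = sum λ v → ∑ᵥ M (f ∘ (v ∷_))

    ∑ᵥ-cong : ∀ M {f g} → (∀ ρ → f ρ ≡ g ρ) → ∑ᵥ M f ≡ ∑ᵥ M g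
    ∑ᵥ-cong zero    f≗g = f≗g []
    ∑ᵥ-cong (suc M) f≗g = sum-cong-≗ λ v → ∑ᵥ-cong M (f≗g ∘ (v ∷_))

    ∑ᵥ-mono : ∀ M {f g} → (∀ ρ → f ρ ≤ g ρ) → ∑ᵥ M f ≤ ∑ᵥ M g
    ∑ᵥ-mono zero    f≤g = f≤g []
    ∑ᵥ-mono (suc M) f≤g = sum-mono λ v → ∑ᵥ-mono M (f≤g ∘ (v ∷_))

    ∑ᵥ-distrib-+ : ∀ M f g → ∑ᵥ M (λ ρ → f ρ + g ρ) ≡ ∑ᵥ M f + ∑ᵥ M g
    ∑ᵥ-distrib-+ zero    f g = refl
    ∑ᵥ-distrib-+ (suc M) f g =
      trans (sum-cong-≗ λ v → ∑ᵥ-distrib-+ M (f ∘ (v ∷_)) (g ∘ (v ∷_)))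
            (∑-distrib-+ (λ v → ∑ᵥ M (f ∘ (v ∷_))) (λ v → ∑ᵥ M (g ∘ (v ∷_))))

    ∑ᵥ-*ˡ : ∀ M c f → ∑ᵥ M (λ ρ → c * f ρ) ≡ c * ∑ᵥ M f
    ∑ᵥ-*ˡ zero    c f = refl
    ∑ᵥ-*ˡ (suc M) c f =
      trans (sum-cong-≗ λ v → ∑ᵥ-*ˡ M c (f ∘ (v ∷_))) (sym (*-distribˡ-sum c λ v → ∑ᵥ M (f ∘ (v ∷_))))

    ∑ᵥ-const : ∀ M c → ∑ᵥ M (λ _ → c) ≡ n ^ M * c
    ∑ᵥ-const zero    c = sym (ℕ.+-identityʳ c)
    ∑ᵥ-const (suc M) c = begin
      sum {n} (λ _ → ∑ᵥ M (λ _ → c)) ≡⟨ cong (λ t → sum {n} λ _ → t) (∑ᵥ-const M c) ⟩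
      sum {n} (λ _ → n ^ M * c)      ≡⟨ sum-const n (n ^ M * c) ⟩
      n * (n ^ M * c)            ≡⟨ ℕ.*-assoc n (n ^ M) c ⟨
      n ^ suc M * c              ∎
      where open ≡-Reasoning

    ∑ᵥ-sum : ∀ M {k} (f : Fin k → Vec (Fin n) M → ℕ) → ∑ᵥ M (λ ρ → sum λ v → f v ρ) ≡ sum λ v → ∑ᵥ M (f v)
    ∑ᵥ-sum M {zero}  f = trans (∑ᵥ-const M 0) (ℕ.*-zeroʳ (n ^ M))
    ∑ᵥ-sum M {suc k} f = trans (∑ᵥ-distrib-+ M _ _) (cong (λ s → ∑ᵥ M (f zero) + s) (∑ᵥ-sum M (f ∘ suc)))

    -- Resampling one coordinate of a uniformly random vector leaves it uniform.
    ∑ᵥ-resample : ∀ M (k : Fin M) f → ∑ᵥ M (λ ρ → sum λ v → f (ρ [ k ]≔ v)) ≡ n * ∑ᵥ M f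
    ∑ᵥ-resample (suc M) zero    f = begin
      sum {n} (λ _ → ∑ᵥ M λ ρ → sum λ v → f (v ∷ ρ))
        ≡⟨ cong (λ t → sum {n} λ _ → t) (∑ᵥ-sum M λ v ρ → f (v ∷ ρ)) ⟩
      sum {n} (λ _ → sum λ v → ∑ᵥ M (f ∘ (v ∷_)))
        ≡⟨ sum-const n _ ⟩
      n * ∑ᵥ (suc M) f ∎
      where open ≡-Reasoning
    ∑ᵥ-resample (suc M) (suc k) f = begin
      sum (λ w → ∑ᵥ M λ ρ → sum λ v → f (w ∷ ρ [ k ]≔ v)) ≡⟨ sum-cong-≗ (λ w → ∑ᵥ-resample M k (f ∘ (w ∷_))) ⟩
      sum (λ w → n * ∑ᵥ M (f ∘ (w ∷_)))                   ≡⟨ *-distribˡ-sum n (λ w → ∑ᵥ M (f ∘ (w ∷_))) ⟨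
      n * ∑ᵥ (suc M) f                                     ∎
      where open ≡-Reasoning

    ∑ᵥ-nonzero : ∀ M {f} → (∀ ρ → f ρ ≢ 0) → n ^ M ≤ ∑ᵥ M f
    ∑ᵥ-nonzero M {f} f≢0 = begin
      n ^ M             ≡⟨ trans (∑ᵥ-const M 1) (ℕ.*-identityʳ (n ^ M)) ⟨
      ∑ᵥ M (λ _ → 1)   ≤⟨ ∑ᵥ-mono M (λ ρ → ℕ.n≢0⇒n>0 (f≢0 ρ)) ⟩
      ∑ᵥ M f           ∎
      where open ℕ.≤-Reasoning

  module Assignments {q N M : ℕ} (a : Fin N → Fin (suc q)) where

    private p = suc q
    open Congruence p
    open SumOverVectors p

    env : Vec (Fin p) M → Var N M → ℤ
    env ρ (inj₁ i) = + toℕ (a i)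
    env ρ (inj₂ j) = + toℕ (lookup ρ j)

    env-update : ∀ ρ j v w → w ≢ inj₂ j → env (ρ [ j ]≔ v) w ≡ env ρ w
    env-update ρ j v (inj₁ i) _   = refl
    env-update ρ j v (inj₂ k) k≢j = cong (+_ ∘ toℕ) (Vec.lookup∘update′ (k≢j ∘ cong inj₂) ρ v)

    residue : ∀ c → Σ (Fin p) λ v → c ≡ₚ + toℕ v
    residue c = fromℕ< (ℤ.n%ℕd<d c p) , mod-p (ℤ.divides (c ℤ./ℕ p) (begin
      c - + toℕ (fromℕ< (ℤ.n%ℕd<d c p))      ≡⟨ cong (λ r → c - + r) (Fin.toℕ-fromℕ< (ℤ.n%ℕd<d c p)) ⟩
      c - + (c ℤ.%ℕ p)                         ≡⟨ cong (_- + (c ℤ.%ℕ p)) (ℤ.a≡a%ℕn+[a/ℕn]*n c p) ⟩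
      + (c ℤ.%ℕ p) ℤ.+ c ℤ./ℕ p ℤ.* + p - + (c ℤ.%ℕ p) ≡⟨ cancel (+ (c ℤ.%ℕ p)) (c ℤ./ℕ p ℤ.* + p) ⟩
      c ℤ./ℕ p ℤ.* + p                        ∎))
      where
      open ≡-Reasoning
      cancel : ∀ r s → r ℤ.+ s - r ≡ s
      cancel = ℤ-solve

    𝟙≢0 : ℤ → ℕ
    𝟙≢0 x with x ≟ₚ0
    ... | yes _ = 0
    ... | no  _ = 1

    𝟙≢0≤1 : ∀ x → 𝟙≢0 x ≤ 1
    𝟙≢0≤1 x with x ≟ₚ0
    ... | yes _ = z≤n
    ... | no  _ = s≤s z≤n

    𝟙≢0≡0⇒≡ₚ0 : ∀ {x} → 𝟙≢0 x ≡ 0 → x ≡ₚ 0ℤ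
    𝟙≢0≡0⇒≡ₚ0 {x} _ with x ≟ₚ0
    𝟙≢0≡0⇒≡ₚ0 _  | yes x≡0 = x≡0
    𝟙≢0≡0⇒≡ₚ0 () | no  _

    ≡ₚ0⇒𝟙≢0≡0 : ∀ {x} → x ≡ₚ 0ℤ → 𝟙≢0 x ≡ 0
    ≡ₚ0⇒𝟙≢0≡0 {x} x≡0 with x ≟ₚ0
    ... | yes _   = refl
    ... | no  x≢0 = contradiction x≡0 x≢0

    𝟙≢0-cong : ∀ {x y} → x ≡ₚ y → 𝟙≢0 x ≡ 𝟙≢0 y
    𝟙≢0-cong {x} {y} x≡y with x ≟ₚ0 | y ≟ₚ0
    ... | yes _   | yes _   = refl
    ... | no  _   | no  _   = refl
    ... | yes x≡0 | no  y≢0 = contradiction (≡ₚ-trans (≡ₚ-sym x≡y) x≡0) y≢0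
    ... | no  x≢0 | yes y≡0 = contradiction (≡ₚ-trans x≡y y≡0) x≢0

    -- Among the p residues v, exactly one makes c - v vanish.
    ∑𝟙≢0[c-v]≤q : ∀ c → sum {p} (λ v → 𝟙≢0 (c - + toℕ v)) ≤ q
    ∑𝟙≢0[c-v]≤q c with v , c≡v ← residue c =
      sum-≤1-with-zero v (≡ₚ0⇒𝟙≢0≡0 (≡ₚ⇒-≡ₚ0 c≡v)) (λ w → 𝟙≢0≤1 (c - + toℕ w))

    module _ {h : ℕ} where

      factor : ExtPoly p N M h → Fin h → Term (Var N M)
      factor e i = g e i ⊖ var (inj₂ (r e i))

      allFactorsNonzero : ExtPoly p N M h → List (Fin h) → Vec (Fin p) M → ℕ
      allFactorsNonzero e []      ρ = 1
      allFactorsNonzero e (i ∷ L) ρ = 𝟙≢0 (⟦ factor e i ⟧ (env ρ)) * allFactorsNonzero e L ρ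

      ⟦factor⟧-update-self : ∀ e i ρ v → ⟦ factor e i ⟧ (env (ρ [ r e i ]≔ v)) ≡ₚ ⟦ g e i ⟧ (env ρ) - + toℕ v
      ⟦factor⟧-update-self e i ρ v = +-congₚ
        (⟦⟧-freeOf (g e i) (fresh e i i) (env-update ρ (r e i) v))
        (≡⇒≡ₚ (cong (ℤ.-_ ∘ +_ ∘ toℕ) (Vec.lookup∘update (r e i) ρ v)))

      ⟦factor⟧-update-other : ∀ e {i j} ρ v → i ≢ j →
                              ⟦ factor e j ⟧ (env (ρ [ r e i ]≔ v)) ≡ₚ ⟦ factor e j ⟧ (env ρ)
      ⟦factor⟧-update-other e {i} {j} ρ v i≢j = +-congₚ
        (⟦⟧-freeOf (g e j) (fresh e i j) (env-update ρ (r e i) v))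
        (≡⇒≡ₚ (cong ℤ.-_ (env-update ρ (r e i) v (inj₂ (r e j)) rⱼ≢rᵢ)))
        where rⱼ≢rᵢ : inj₂ (r e j) ≢ inj₂ (r e i)
              rⱼ≢rᵢ rⱼ≡rᵢ = i≢j (sym (r-inj e j i (inj₂-injective rⱼ≡rᵢ)))

      allFactorsNonzero-update : ∀ e {i} L ρ v → All (i ≢_) L →
                                 allFactorsNonzero e L (ρ [ r e i ]≔ v) ≡ allFactorsNonzero e L ρ
      allFactorsNonzero-update e []      ρ v []           = refl
      allFactorsNonzero-update e (j ∷ L) ρ v (i≢j ∷ i∉L) = cong₂ _*_
        (𝟙≢0-cong (⟦factor⟧-update-other e ρ v i≢j)) (allFactorsNonzero-update e L ρ v i∉L)

      -- Resampling r_i shows that a further factor g_i - r_i, with r_i fresh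
      -- for the others, is nonzero on at most a fraction q/p of the assignments.
      p*∑allFactorsNonzero≤q*∑ : ∀ e i L → All (i ≢_) L →
        p * ∑ᵥ M (allFactorsNonzero e (i ∷ L)) ≤ q * ∑ᵥ M (allFactorsNonzero e L)
      p*∑allFactorsNonzero≤q*∑ e i L i∉L = begin
        p * ∑ᵥ M (λ ρ → 𝟙ᵢ ρ * B ρ)
          ≡⟨ ∑ᵥ-resample M (r e i) (λ ρ → 𝟙ᵢ ρ * B ρ) ⟨
        ∑ᵥ M (λ ρ → sum {p} λ v → 𝟙ᵢ (ρ [ r e i ]≔ v) * B (ρ [ r e i ]≔ v))
          ≡⟨ ∑ᵥ-cong M (λ ρ → sum-cong-≗ λ v → cong₂ _*_
               (𝟙≢0-cong (⟦factor⟧-update-self e i ρ v)) (allFactorsNonzero-update e L ρ v i∉L)) ⟩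
        ∑ᵥ M (λ ρ → sum {p} λ v → 𝟙≢0 (c ρ - + toℕ v) * B ρ)
          ≡⟨ ∑ᵥ-cong M (λ ρ → *-distribʳ-sum {p} (B ρ) (λ v → 𝟙≢0 (c ρ - + toℕ v))) ⟨
        ∑ᵥ M (λ ρ → sum {p} (λ v → 𝟙≢0 (c ρ - + toℕ v)) * B ρ)
          ≤⟨ ∑ᵥ-mono M (λ ρ → ℕ.*-monoˡ-≤ (B ρ) (∑𝟙≢0[c-v]≤q (c ρ))) ⟩
        ∑ᵥ M (λ ρ → q * B ρ)
          ≡⟨ ∑ᵥ-*ˡ M q B ⟩
        q * ∑ᵥ M B ∎
        where
        open ℕ.≤-Reasoning
        𝟙ᵢ = λ ρ → 𝟙≢0 (⟦ factor e i ⟧ (env ρ))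
        B = allFactorsNonzero e L
        c = λ ρ → ⟦ g e i ⟧ (env ρ)

      p^|L|*∑allFactorsNonzero≤q^|L|*p^M : ∀ e L → AllPairs _≢_ L →
        p ^ length L * ∑ᵥ M (allFactorsNonzero e L) ≤ q ^ length L * p ^ M
      p^|L|*∑allFactorsNonzero≤q^|L|*p^M e [] [] = ℕ.≤-reflexive (cong (1 *_) (trans (∑ᵥ-const M 1) (ℕ.*-identityʳ (p ^ M))))
      p^|L|*∑allFactorsNonzero≤q^|L|*p^M e (i ∷ L) (i∉L ∷ L-distinct) = begin
        p * p ^ l * ∑ᵥ M (allFactorsNonzero e (i ∷ L))   ≡⟨ rearrange p (p ^ l) _ ⟩
        p ^ l * (p * ∑ᵥ M (allFactorsNonzero e (i ∷ L))) ≤⟨ ℕ.*-monoʳ-≤ (p ^ l) (p*∑allFactorsNonzero≤q*∑ e i L i∉L) ⟩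
        p ^ l * (q * ∑ᵥ M (allFactorsNonzero e L))       ≡⟨ rearrange′ (p ^ l) q _ ⟩
        q * (p ^ l * ∑ᵥ M (allFactorsNonzero e L))       ≤⟨ ℕ.*-monoʳ-≤ q (p^|L|*∑allFactorsNonzero≤q^|L|*p^M e L L-distinct) ⟩
        q * (q ^ l * p ^ M)                               ≡⟨ ℕ.*-assoc q (q ^ l) (p ^ M) ⟨
        q * q ^ l * p ^ M                                 ∎
        where
        open ℕ.≤-Reasoning
        l = length L
        rearrange : ∀ a b c → a * b * c ≡ b * (a * c)
        rearrange = solve-∀
        rearrange′ : ∀ a b c → a * (b * c) ≡ b * (a * c)
        rearrange′ = solve-∀

      someNonzero : List (ExtPoly p N M h) → Vec (Fin p) M → ℕ
      someNonzero []      ρ = 0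
      someNonzero (e ∷ E) ρ = allFactorsNonzero e (allFin h) ρ + someNonzero E ρ

      p^h*∑someNonzero≤|E|*q^h*p^M : ∀ E → p ^ h * ∑ᵥ M (someNonzero E) ≤ length E * (q ^ h * p ^ M)
      p^h*∑someNonzero≤|E|*q^h*p^M [] = ℕ.≤-reflexive
        (trans (cong (p ^ h *_) (trans (∑ᵥ-const M 0) (ℕ.*-zeroʳ (p ^ M)))) (ℕ.*-zeroʳ (p ^ h)))
      p^h*∑someNonzero≤|E|*q^h*p^M (e ∷ E) = begin
        p ^ h * ∑ᵥ M (someNonzero (e ∷ E))
          ≡⟨ cong (p ^ h *_) (∑ᵥ-distrib-+ M (allFactorsNonzero e (allFin h)) (someNonzero E)) ⟩
        p ^ h * (∑ᵥ M (allFactorsNonzero e (allFin h)) + ∑ᵥ M (someNonzero E))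
          ≡⟨ ℕ.*-distribˡ-+ (p ^ h) _ _ ⟩
        p ^ h * ∑ᵥ M (allFactorsNonzero e (allFin h)) + p ^ h * ∑ᵥ M (someNonzero E)
          ≤⟨ ℕ.+-mono-≤ one-poly (p^h*∑someNonzero≤|E|*q^h*p^M E) ⟩
        q ^ h * p ^ M + length E * (q ^ h * p ^ M) ∎
        where
        open ℕ.≤-Reasoning
        one-poly : p ^ h * ∑ᵥ M (allFactorsNonzero e (allFin h)) ≤ q ^ h * p ^ M
        one-poly = subst (λ l → p ^ l * ∑ᵥ M (allFactorsNonzero e (allFin h)) ≤ q ^ l * p ^ M)
                     (List.length-tabulate {n = h} id) (p^|L|*∑allFactorsNonzero≤q^|L|*p^M e (allFin h) (allFin⁺ h))

      allFactorsNonzero≡0⇒⟦∏⟧≡ₚ0 : ∀ e L ρ → allFactorsNonzero e L ρ ≡ 0 →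
        ⟦ List.foldr _⊗_ (con 1) (map (factor e) L) ⟧ (env ρ) ≡ₚ 0ℤ
      allFactorsNonzero≡0⇒⟦∏⟧≡ₚ0 e []      ρ ()
      allFactorsNonzero≡0⇒⟦∏⟧≡ₚ0 e (i ∷ L) ρ ≡0 with ℕ.m*n≡0⇒m≡0∨n≡0 (𝟙≢0 (⟦ factor e i ⟧ (env ρ))) ≡0
      ... | inj₁ 𝟙ᵢ≡0 = x≡ₚ0⇒x*y≡ₚ0 _ (𝟙≢0≡0⇒≡ₚ0 𝟙ᵢ≡0)
      ... | inj₂ B≡0  = y≡ₚ0⇒x*y≡ₚ0 (⟦ factor e i ⟧ (env ρ)) (allFactorsNonzero≡0⇒⟦∏⟧≡ₚ0 e L ρ B≡0)

      someNonzero≡0⇒polys≡ₚ0 : ∀ E ρ → someNonzero E ρ ≡ 0 → All (λ t → ⟦ t ⟧ (env ρ) ≡ₚ 0ℤ) (map poly E)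
      someNonzero≡0⇒polys≡ₚ0 []      ρ _  = []
      someNonzero≡0⇒polys≡ₚ0 (e ∷ E) ρ ≡0 =
        allFactorsNonzero≡0⇒⟦∏⟧≡ₚ0 e (allFin h) ρ (ℕ.m+n≡0⇒m≡0 _ ≡0) ∷
        someNonzero≡0⇒polys≡ₚ0 E ρ (ℕ.m+n≡0⇒n≡0 _ ≡0)

      R≡ₚ0 : Prime p → ∀ E ρ → All (λ t → ⟦ t ⟧ (env ρ) ≡ₚ 0ℤ) (Rset E)
      R≡ₚ0 p-prime []      ρ = []
      R≡ₚ0 p-prime (e ∷ E) ρ = ++⁺ (map⁺ {f = rᵖ-r} (All.universal rᵖ-r≡ₚ0 (allFin h))) (R≡ₚ0 p-prime E ρ)
        where
        rᵖ-r : Fin h → Term (Var N M)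
        rᵖ-r i = (var (inj₂ (r e i)) ^T p) ⊖ var (inj₂ (r e i))
        rᵖ-r≡ₚ0 : ∀ i → ⟦ rᵖ-r i ⟧ (env ρ) ≡ₚ 0ℤ
        rᵖ-r≡ₚ0 i = ≡ₚ⇒-≡ₚ0 (subst (_≡ₚ + x) (sym (⟦^T⟧ (var (inj₂ (r e i))) p (env ρ))) (fermat p-prime x))
          where x = toℕ (lookup ρ (r e i))

    solution⇒≡ₚ0 : ∀ {F} → All (λ f → + p ∣ eval a f) F →
                   ∀ ρ → All (λ t → ⟦ t ⟧ (env ρ) ≡ₚ 0ℤ) (map (rename inj₁) F)
    solution⇒≡ₚ0 a-solves ρ = map⁺ (All.map (λ {f} → ∣⇒≡ₚ0 ∘ subst (+ p ℤ.∣_) (eval≡⟦rename⟧ f) ∘ ℤ.∣ᵤ⇒∣) a-solves)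
      where eval≡⟦rename⟧ : ∀ f → eval a f ≡ ⟦ rename inj₁ f ⟧ (env ρ)
            eval≡⟦rename⟧ f = trans (eval≡⟦⟧ a f) (sym (⟦rename⟧ inj₁ f (env ρ)))

open import Data.Nat as ℕ using (suc; _*_; _^_; _<_; s≤s)
open import Data.Integer using (0ℤ)
import Data.Nat.Properties as ℕ
open import Data.Nat.Primality using (prime⇒nonTrivial)
open import Data.List.Relation.Unary.All.Properties using (++⁺)
open ExponentialBound using (LtExp⇒m*q^h<[1+q]^h)
open Evaluation using (⟦_⟧; NSRefutation⇒¬commonZero)
open Counting

lemma2p4 : (p : ℕ) → Prime p → (N M : ℕ) → (F : List (Term (Fin N)))
  → (∀ i → Any (λ f → p ⊢ f ≈ (xv i ^T 2) ⊖ xv i) F)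
  → (h : ℕ) → 1 ≤ h → (E : List (ExtPoly p N M h))
  → AllPairs (λ e e′ → ¬ (p ⊢ poly e ≈ poly e′)) E
  → LtExp (length E) h p
  → NSRefutation p (map (rename inj₁) F ++ map poly E ++ Rset E)
  → ¬ Σ (Fin N → Fin p) (λ a → All (λ f → + p ∣ eval a f) F)
lemma2p4 p p-prime N M F _ h _ E _ |E|<e^[h/p] refutation (a , a-solves)
  with ℕ.nonTrivial⇒n>1 p {{prime⇒nonTrivial p-prime}}
lemma2p4 p@(suc q) p-prime N M F _ h _ E _ |E|<e^[h/p] refutation (a , a-solves) | s≤s 1≤q =
  ℕ.<⇒≱ ∑someNonzero<p^M (∑ᵥ-nonzero M λ ρ someNonzero≡0 →
    NSRefutation⇒¬commonZero (s≤s 1≤q) refutation (env ρ) (commonZero ρ someNonzero≡0))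
  where
  open Assignments {q} {N} {M} a
  open SumOverVectors p
  open Congruence p using (_≡ₚ_)

  ∑someNonzero<p^M : ∑ᵥ M (someNonzero E) < p ^ M
  ∑someNonzero<p^M = ℕ.*-cancelˡ-< (p ^ h) _ _ (begin-strict
    p ^ h * ∑ᵥ M (someNonzero E) ≤⟨ p^h*∑someNonzero≤|E|*q^h*p^M E ⟩
    length E * (q ^ h * p ^ M)    ≡⟨ ℕ.*-assoc (length E) (q ^ h) (p ^ M) ⟨
    length E * q ^ h * p ^ M      <⟨ ℕ.*-monoˡ-< (p ^ M) {{ℕ.m^n≢0 p M}} |E|q^h<p^h ⟩
    p ^ h * p ^ M                 ∎)
    where
    open ℕ.≤-Reasoning
    |E|q^h<p^h = LtExp⇒m*q^h<[1+q]^h q h (length E) 1≤q |E|<e^[h/p]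

  commonZero : ∀ ρ → someNonzero E ρ ≡ 0 →
    All (λ t → ⟦ t ⟧ (env ρ) ≡ₚ 0ℤ) (map (rename inj₁) F ++ map poly E ++ Rset E)
  commonZero ρ someNonzero≡0 =
    ++⁺ (solution⇒≡ₚ0 a-solves ρ) (++⁺ (someNonzero≡0⇒polys≡ₚ0 E ρ someNonzero≡0) (R≡ₚ0 p-prime E ρ))
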